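{- Let $m \geq 4$ and let $\Delta_m$ be the edge-coloured graph defined in the context. Then: (1) There exists a transversal graph $T$ of $\Delta_m$ that has no edge-colour complement among the transversal graphs of $\Delta_m$; that is, no transversal graph of $\Delta_m$ is isomorphic, as an edge-coloured graph, to the graph obtained from $T$ by interchanging the colours red and blue. In particular, it is false that for every transversal graph $T$ of $\Delta_m$ there is a transversal graph edge-colour complementary to $T$. (2) Consequently, (a) the set of transversal graphs of $\Delta_m$ that are not self-edge-colour-complementary cannot be partitioned into pairs in which each member is edge-colour complementary to the other, and (b) there is no permutation $\pi$ of the $4^m$ vertices of $\Delta_m$ that sends every amicable pair of basis matrices with disjoint support (blue edge) to an anti-amicable pair with disjoint support (red edge), and vice versa. (3) The only $m \geq 1$ for which there exists an automorphism of $\Delta_m$ (as an uncoloured graph) that swaps the subgraphs $\Delta_m[-1]$ and $\Delta_m[1]$ are $m = 1, 2, 3$.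
   Context: Let $E_1 = \begin{pmatrix} 0 & -1 \\ 1 & 0\end{pmatrix}$, $E_2 = \begin{pmatrix} 0 & 1\\ 1 & 0\end{pmatrix}$, and set $M_0 = I_2$, $M_1 = E_1$, $M_2 = E_2$, $M_3 = E_1E_2$. For $m\ge1$ and an $m$-digit base-4 string $d_{m-1}\ldots d_1 d_0$ (equivalently an element of $\mathbb{Z}_2^{2m}$, each digit being a pair of bits), let $\gamma_m(d_{m-1}\ldots d_0) = M_{d_{m-1}} \otimes \cdots \otimes M_{d_0}$, a $2^m\times 2^m$ signed permutation matrix; these $4^m$ matrices form the positive signed basis of the real monomial representation of the Clifford algebra $\mathbb{R}_{m,m}$. Two such matrices $A,B$ have disjoint support if no position has nonzero entries in both. $A,B$ are called amicable if $AB^{ -1}$ ($=AB^T$) is symmetric and anti-amicable if $AB^{ -1}$ is skew. The graph $\Delta_m$ has these $4^m$ matrices as vertices; distinct $A,B$ are joined by a red edge (label $-1$) if they have disjoint support and are anti-amicable, by a blue edge (label $1$) if they have disjoint support and are amicable, and are not joined otherwise. $\Delta_m[-1]$ (resp. $\Delta_m[1]$) is the spanning subgraph consisting of all vertices of $\Delta_m$ and all its red (resp. blue) edges. A transversal graph of $\Delta_m$ is any induced subgraph of $\Delta_m$ on $2^m$ vertices that is a complete graph, i.e. every pair of its vertices has disjoint support; its edges retain their colours. Two edge-coloured graphs are edge-colour complementary if one is isomorphic, as an edge-coloured graph, to the graph obtained from the other by interchanging red and blue; a graph is self-edge-colour-complementary if it is edge-colour complementary to itself. -}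

module Defs where

open import Data.Nat using (ℕ; zero; suc; _^_)
open import Data.Bool using (Bool; true; false)
open import Data.Fin using (Fin)
open import Data.Integer using (ℤ; +_; -[1+_]; _+_; _*_; -_)
open import Data.List using (List; []; _∷_; _++_; map; foldr)
open import Data.Vec using (Vec; []; _∷_)
open import Data.Product using (Σ; _×_; ∃)
open import Data.Sum using (_⊎_)
open import Relation.Binary.PropositionalEquality using (_≡_; _≢_)
open import Relation.Nullary using (¬_)
open import Function.Bundles using (_↔_; _⇔_; Inverse)

-- Real (here: integer-valued) 2^m × 2^m matrices.
-- Rows/columns are indexed by bit strings of length m; the first bit
-- corresponds to the leftmost Kronecker factor (lexicographic order).

Idx : ℕ → Set
Idx m = Vec Bool m

Mat : ℕ → Set
Mat m = Idx m → Idx m → ℤ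

allIdx : (m : ℕ) → List (Idx m)
allIdx zero    = [] ∷ []
allIdx (suc m) = map (false ∷_) (allIdx m) ++ map (true ∷_) (allIdx m)

sumℤ : List ℤ → ℤ
sumℤ = foldr _+_ (+ 0)

_·_ : ∀ {m} → Mat m → Mat m → Mat m
_·_ {m} A B i j = sumℤ (map (λ k → A i k * B k j) (allIdx m))

transpose : ∀ {m} → Mat m → Mat m
transpose A i j = A j i

-- The 2 × 2 matrices (index false = first row/column, true = second)

Mat2 : Set
Mat2 = Bool → Bool → ℤ

I₂ : Mat2
I₂ false false = + 1
I₂ false true  = + 0
I₂ true  false = + 0
I₂ true  true  = + 1

E₁ : Mat2
E₁ false false = + 0
E₁ false true  = -[1+ 0 ]
E₁ true  false = + 1
E₁ true  true  = + 0

E₂ : Mat2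
E₂ false false = + 0
E₂ false true  = + 1
E₂ true  false = + 1
E₂ true  true  = + 0

_·₂_ : Mat2 → Mat2 → Mat2
(A ·₂ B) i j = A i false * B false j + A i true * B true j

M : Fin 4 → Mat2
M Fin.zero                         = I₂
M (Fin.suc Fin.zero)               = E₁
M (Fin.suc (Fin.suc Fin.zero))     = E₂
M (Fin.suc (Fin.suc (Fin.suc _)))  = E₁ ·₂ E₂

-- Vertices of Δ_m: base-4 strings d_{m-1} … d_0 (head = d_{m-1})

Vertex : ℕ → Set
Vertex m = Vec (Fin 4) m

-- γ_m(d_{m-1} … d_0) = M_{d_{m-1}} ⊗ ⋯ ⊗ M_{d_0}  (Kronecker product)
γ : ∀ {m} → Vertex m → Mat m
γ []       []       []       = + 1
γ (d ∷ ds) (i ∷ is) (j ∷ js) = M d i j * γ ds is js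

DisjointSupport : ∀ {m} → Mat m → Mat m → Set
DisjointSupport A B = ∀ i j → A i j ≡ + 0 ⊎ B i j ≡ + 0

Symmetric : ∀ {m} → Mat m → Set
Symmetric P = ∀ i j → P i j ≡ P j i

Skew : ∀ {m} → Mat m → Set
Skew P = ∀ i j → P i j ≡ - P j i

-- for signed permutation matrices B⁻¹ = Bᵀ
Amicable : ∀ {m} → Mat m → Mat m → Set
Amicable A B = Symmetric (A · transpose B)

AntiAmicable : ∀ {m} → Mat m → Mat m → Set
AntiAmicable A B = Skew (A · transpose B)

Adj : ∀ {m} → Vertex m → Vertex m → Set
Adj a b = a ≢ b × DisjointSupport (γ a) (γ b)

-- red edge (label -1): edge of Δ_m[-1]
Red : ∀ {m} → Vertex m → Vertex m → Set
Red a b = Adj a b × AntiAmicable (γ a) (γ b)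

-- blue edge (label 1): edge of Δ_m[1]
Blue : ∀ {m} → Vertex m → Vertex m → Set
Blue a b = Adj a b × Amicable (γ a) (γ b)

-- Transversal graphs: 2^m vertices of Δ_m, pairwise adjacent
-- (given as an enumeration of the vertex set of the induced subgraph)

record Transversal (m : ℕ) : Set where
  field
    vert     : Fin (2 ^ m) → Vertex m
    complete : ∀ i j → i ≢ j → Adj (vert i) (vert j)
open Transversal public

SameGraph : ∀ {m} → Transversal m → Transversal m → Set
SameGraph T T' = ∀ v → ((∃ λ i → vert T i ≡ v) ⇔ (∃ λ j → vert T' j ≡ v))

EdgeColourComplementary : ∀ {m} → Transversal m → Transversal m → Set
EdgeColourComplementary {m} T T' =
  Σ (Fin (2 ^ m) ↔ Fin (2 ^ m)) λ σ →
    ∀ i j → i ≢ j →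
      (Red  (vert T i) (vert T j) ⇔ Blue (vert T' (Inverse.to σ i)) (vert T' (Inverse.to σ j)))
    × (Blue (vert T i) (vert T j) ⇔ Red  (vert T' (Inverse.to σ i)) (vert T' (Inverse.to σ j)))

SelfEdgeColourComplementary : ∀ {m} → Transversal m → Set
SelfEdgeColourComplementary T = EdgeColourComplementary T T

-- A partition of the non-self-edge-colour-complementary transversal
-- graphs into pairs {T, f T} of mutually edge-colour complementary graphs.
IsComplementaryPairing : ∀ {m} →
  ((T : Transversal m) → ¬ SelfEdgeColourComplementary T → Transversal m) → Set
IsComplementaryPairing {m} f =
    (∀ T nT → EdgeColourComplementary T (f T nT))
  × (∀ T nT → ¬ SameGraph (f T nT) T)
  × (∀ T nT (nT' : ¬ SelfEdgeColourComplementary (f T nT)) → SameGraph (f (f T nT) nT') T)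
  × (∀ T T' nT nT' → SameGraph T T' → SameGraph (f T nT) (f T' nT'))

SwapsColours : ∀ {m} → (Vertex m ↔ Vertex m) → Set
SwapsColours {m} π = ∀ (a b : Vertex m) →
    (Blue a b → Red  (Inverse.to π a) (Inverse.to π b))
  × (Red  a b → Blue (Inverse.to π a) (Inverse.to π b))

IsColourSwappingAutomorphism : ∀ {m} → (Vertex m ↔ Vertex m) → Set
IsColourSwappingAutomorphism {m} π = ∀ (a b : Vertex m) →
    (Adj  a b ⇔ Adj  (Inverse.to π a) (Inverse.to π b))
  × (Red  a b ⇔ Blue (Inverse.to π a) (Inverse.to π b))
  × (Blue a b ⇔ Red  (Inverse.to π a) (Inverse.to π b))

-- Write a vertex as a word d_{m-1} … d_0 of digits. Then γ a is the signed permutation matrix of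
-- i ↦ i ⊕ support a, where the support word records which factors M_d are antidiagonal, so two
-- vertices are adjacent exactly when their supports differ. The product γ a · γ bᵀ factors digitwise
-- into 2 × 2 matrices that are each symmetric or skew, the skew ones coming from the digit pairs
-- {0,1} and {2,3}; so the parity of the number of such pairs is the colour of an edge.
--
-- The vertices with digits 0 and 2 (factors I and E₂) form a transversal with only blue edges. An
-- edge-colour complement of it, and also its image under a colour-swapping permutation, would be a
-- transversal with only red edges: one vertex of each of the 2^m supports, pairwise of odd parity.
-- For m = 4 an exhaustive backtracking search shows that no such choice exists, and restricting to
-- the supports with leading bit 0 reduces every m ≥ 4 to m = 4. For m ≤ 3 explicit involutions of
-- the vertex set that swap the colours are checked by computation.

module Submission where

open import Defs
open import Data.Nat using (ℕ; zero; suc; s≤s; _≤_; _≤′_; ≤′-refl; ≤′-step; _^_)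
open import Data.Nat.Properties using (≤⇒≤′; n<1+n; ≰⇒>) renaming (_≤?_ to _≤ℕ?_)
open import Data.Bool using (Bool; true; false; not; _xor_; _∧_; T) renaming (_≟_ to _≟ᵇ_)
open import Data.Bool.Properties using (T-≡; T-∧)
open import Data.Fin using (Fin; zero; punchOut) renaming (_≟_ to _≟ꟳ_)
open import Data.Fin.Patterns using (0F; 1F; 2F; 3F)
open import Data.Fin.Properties using (all?; any?; *↔×; 2↔Bool; punchOut-injective; <⇒notInjective)
open import Data.Integer using (ℤ; +_; _+_; _*_; -_; -1ℤ; 1ℤ)
open import Data.Integer.Properties
  using ( neg-involutive; +-identityˡ; +-assoc; *-zeroʳ; *-identityˡ; -1*i≡-i; i*j≡0⇒i≡0∨j≡0
        ; *-distribʳ-+; *-distribˡ-+; *-commutativeSemigroup)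
  renaming (_≟_ to _≟ℤ_)
open import Algebra.Properties.CommutativeSemigroup *-commutativeSemigroup using (interchange)
open import Data.List using (List; []; _∷_; _++_; map; cartesianProductWith)
open import Data.Bool.ListAction using (any; all)
open import Data.List.Membership.Propositional using (_∈_; lose)
open import Data.List.Membership.Propositional.Properties using (∈-cartesianProductWith⁺)
open import Data.List.Relation.Unary.Any using (here; there)
open import Data.List.Relation.Unary.Any.Properties using (any⁺)
open import Data.List.Relation.Unary.All using (All; []; _∷_)
import Data.List.Relation.Unary.All as All
open import Data.List.Relation.Unary.All.Properties using (all⁻)
open import Data.List.Relation.Unary.AllPairs using (AllPairs; []; _∷_; allPairs?)
open import Data.List.Properties using (map-++; map-∘; map-cong)
open import Data.Vec using (Vec; []; _∷_; replicate; zipWith)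
import Data.Vec as Vec
open import Data.Vec.Properties using (∷-injective; ≡-dec)
open import Data.Product using (Σ; _×_; _,_; proj₁; proj₂; ∃; uncurry)
open import Data.Sum using (inj₁; inj₂)
open import Data.Empty using (⊥-elim)
open import Function using (_∘_; _$_)
open import Function.Bundles using (_⇔_; mk⇔; Equivalence; _↔_; mk↔ₛ′; Inverse; Injection)
open import Function.Definitions using (Injective)
open import Function.Properties.Inverse using (↔-trans; ↔-sym; Inverse⇒Injection)
open import Function.Construct.Identity using (⇔-id)
open import Data.Product.Function.NonDependent.Propositional using (_×-⇔_; _×-↔_)
open import Relation.Binary.PropositionalEquality
open import Relation.Nullary using (¬_; Dec; yes; no; map′; _×-dec_; ¬?; _→-dec_; contradiction)
open import Relation.Nullary.Decidable using (from-yes; True; toWitness)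
open import Relation.Unary using (Decidable)
open import Algebra.Definitions using (Involutive)

sign : Bool → ℤ
sign false = 1ℤ
sign true  = -1ℤ

sign-xor : ∀ x y → sign (x xor y) ≡ sign x * sign y
sign-xor false false = refl
sign-xor false true  = refl
sign-xor true  false = refl
sign-xor true  true  = refl

x≡-x⇒x≡0 : ∀ {x} → x ≡ - x → x ≡ + 0
x≡-x⇒x≡0 {+ zero} _ = refl

x*y≢0 : ∀ {x y} → x ≢ + 0 → y ≢ + 0 → x * y ≢ + 0
x*y≢0 {x} x≢0 y≢0 xy≡0 with i*j≡0⇒i≡0∨j≡0 x xy≡0
... | inj₁ x≡0 = x≢0 x≡0
... | inj₂ y≡0 = y≢0 y≡0

x*y≢0⇒x≢0 : ∀ {x y} → x * y ≢ + 0 → x ≢ + 0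
x*y≢0⇒x≢0 xy≢0 refl = xy≢0 refl

x*y≢0⇒y≢0 : ∀ {x y} → x * y ≢ + 0 → y ≢ + 0
x*y≢0⇒y≢0 {x} xy≢0 refl = xy≢0 (*-zeroʳ x)

sumℤ-++ : ∀ xs ys → sumℤ (xs ++ ys) ≡ sumℤ xs + sumℤ ys
sumℤ-++ []       ys = sym (+-identityˡ (sumℤ ys))
sumℤ-++ (x ∷ xs) ys = trans (cong (λ s → x + s) (sumℤ-++ xs ys)) (sym (+-assoc x (sumℤ xs) (sumℤ ys)))

sumℤ-scale : ∀ {A : Set} c (f : A → ℤ) xs → sumℤ (map (λ k → c * f k) xs) ≡ c * sumℤ (map f xs)
sumℤ-scale c f []       = sym (*-zeroʳ c)
sumℤ-scale c f (x ∷ xs) =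
  trans (cong (λ s → c * f x + s) (sumℤ-scale c f xs)) (sym (*-distribˡ-+ c (f x) (sumℤ (map f xs))))

sumℤ-allIdx : ∀ {m} (f : Idx (suc m) → ℤ) →
  sumℤ (map f (allIdx (suc m)))
    ≡ sumℤ (map (f ∘ (false ∷_)) (allIdx m)) + sumℤ (map (f ∘ (true ∷_)) (allIdx m))
sumℤ-allIdx {m} f = begin
  sumℤ (map f (map (false ∷_) L ++ map (true ∷_) L))
    ≡⟨ cong sumℤ (map-++ f (map (false ∷_) L) _) ⟩
  sumℤ (map f (map (false ∷_) L) ++ map f (map (true ∷_) L))
    ≡⟨ sumℤ-++ (map f (map (false ∷_) L)) _ ⟩
  sumℤ (map f (map (false ∷_) L)) + sumℤ (map f (map (true ∷_) L))
    ≡⟨ cong₂ _+_ (cong sumℤ (sym (map-∘ L))) (cong sumℤ (sym (map-∘ L))) ⟩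
  sumℤ (map (f ∘ (false ∷_)) L) + sumℤ (map (f ∘ (true ∷_)) L)
    ∎
  where
  open ≡-Reasoning
  L : List (Idx m)
  L = allIdx m

∀-Bool? : ∀ {P : Bool → Set} → Decidable P → Dec (∀ b → P b)
∀-Bool? P? =
  map′ (λ { (f , t) false → f ; (f , t) true → t }) (λ h → h false , h true) (P? false ×-dec P? true)

-- Digit matrices and the colour of an edge

digitSupport : Fin 4 → Bool
digitSupport 0F = false
digitSupport 1F = true
digitSupport 2F = true
digitSupport 3F = false

digitSkew : Fin 4 → Fin 4 → Bool
digitSkew 0F 1F = true
digitSkew 1F 0F = true
digitSkew 2F 3F = true
digitSkew 3F 2F = true
digitSkew _  _  = false

M·Mᵀ : Fin 4 → Fin 4 → Mat2
M·Mᵀ d e = M d ·₂ λ i j → M e j i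

M-support : ∀ d i j → M d i j ≢ + 0 → i xor j ≡ digitSupport d
M-support = from-yes $ all? λ d → ∀-Bool? λ i → ∀-Bool? λ j →
  ¬? (M d i j ≟ℤ + 0) →-dec (i xor j ≟ᵇ digitSupport d)

M-nonzero : ∀ d → M d false (digitSupport d) ≢ + 0
M-nonzero = from-yes $ all? λ d → ¬? (M d false (digitSupport d) ≟ℤ + 0)

M·Mᵀ-symmetry : ∀ d e i j → M·Mᵀ d e j i ≡ sign (digitSkew d e) * M·Mᵀ d e i j
M·Mᵀ-symmetry = from-yes $ all? λ d → all? λ e → ∀-Bool? λ i → ∀-Bool? λ j →
  M·Mᵀ d e j i ≟ℤ sign (digitSkew d e) * M·Mᵀ d e i j

M·Mᵀ-nonzero : ∀ d e → M·Mᵀ d e false (digitSupport d xor digitSupport e) ≢ + 0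
M·Mᵀ-nonzero = from-yes $ all? λ d → all? λ e →
  ¬? (M·Mᵀ d e false (digitSupport d xor digitSupport e) ≟ℤ + 0)

support : ∀ {m} → Vertex m → Vec Bool m
support = Vec.map digitSupport

isSkew : ∀ {m} → Vertex m → Vertex m → Bool
isSkew []      []      = false
isSkew (d ∷ a) (e ∷ b) = digitSkew d e xor isSkew a b

_⊕_ : ∀ {m} → Vec Bool m → Vec Bool m → Vec Bool m
_⊕_ = zipWith _xor_

γ-support : ∀ {m} (a : Vertex m) i j → γ a i j ≢ + 0 → i ⊕ j ≡ support a
γ-support []      []      []      _   = refl
γ-support (d ∷ a) (i ∷ is) (j ∷ js) γ≢0 =
  cong₂ _∷_ (M-support d i j (x*y≢0⇒x≢0 γ≢0)) (γ-support a is js (x*y≢0⇒y≢0 {M d i j} γ≢0))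

γ-nonzero : ∀ {m} (a : Vertex m) → γ a (replicate m false) (support a) ≢ + 0
γ-nonzero []      = λ ()
γ-nonzero (d ∷ a) = x*y≢0 (M-nonzero d) (γ-nonzero a)

disjointSupport⇔support≢ : ∀ {m} (a b : Vertex m) →
  DisjointSupport (γ a) (γ b) ⇔ support a ≢ support b
disjointSupport⇔support≢ {m} a b = mk⇔ disjoint⇒ ⇒disjoint
  where
  disjoint⇒ : DisjointSupport (γ a) (γ b) → support a ≢ support b
  disjoint⇒ disjoint sa≡sb with disjoint (replicate m false) (support a)
  ... | inj₁ γa≡0 = γ-nonzero a γa≡0
  ... | inj₂ γb≡0 = γ-nonzero b (subst (λ s → γ b (replicate m false) s ≡ + 0) sa≡sb γb≡0)
  ⇒disjoint : support a ≢ support b → DisjointSupport (γ a) (γ b)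
  ⇒disjoint sa≢sb i j with γ a i j ≟ℤ + 0 | γ b i j ≟ℤ + 0
  ... | yes γa≡0 | _          = inj₁ γa≡0
  ... | no _     | yes γb≡0   = inj₂ γb≡0
  ... | no γa≢0  | no γb≢0    =
    contradiction (trans (sym (γ-support a i j γa≢0)) (γ-support b i j γb≢0)) sa≢sb

γγᵀ : ∀ {m} → Vertex m → Vertex m → Mat m
γγᵀ a b = γ a · transpose (γ b)

γγᵀ-∷ : ∀ {m} d e (a b : Vertex m) i j is js →
  γγᵀ (d ∷ a) (e ∷ b) (i ∷ is) (j ∷ js) ≡ M·Mᵀ d e i j * γγᵀ a b is js
γγᵀ-∷ {m} d e a b i j is js = begin
  sumℤ (map f (allIdx (suc m)))
    ≡⟨ sumℤ-allIdx f ⟩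
  sumℤ (map (f ∘ (false ∷_)) L) + sumℤ (map (f ∘ (true ∷_)) L)
    ≡⟨ cong₂ _+_ (column false) (column true) ⟩
  M d i false * M e j false * S + M d i true * M e j true * S
    ≡⟨ sym (*-distribʳ-+ S (M d i false * M e j false) (M d i true * M e j true)) ⟩
  M·Mᵀ d e i j * S
    ∎
  where
  open ≡-Reasoning
  L : List (Idx m)
  L = allIdx m
  S : ℤ
  S = γγᵀ a b is js
  f : Idx (suc m) → ℤ
  f k = γ (d ∷ a) (i ∷ is) k * γ (e ∷ b) (j ∷ js) k
  column : ∀ k₀ → sumℤ (map (f ∘ (k₀ ∷_)) L) ≡ M d i k₀ * M e j k₀ * S
  column k₀ = trans
    (cong sumℤ (map-cong (λ k → interchange (M d i k₀) (γ a is k) (M e j k₀) (γ b js k)) L))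
    (sumℤ-scale (M d i k₀ * M e j k₀) (λ k → γ a is k * γ b js k) L)

γγᵀ-symmetry : ∀ {m} (a b : Vertex m) i j → γγᵀ a b j i ≡ sign (isSkew a b) * γγᵀ a b i j
γγᵀ-symmetry []      []      []       []       = refl
γγᵀ-symmetry (d ∷ a) (e ∷ b) (i ∷ is) (j ∷ js) = begin
  γγᵀ (d ∷ a) (e ∷ b) (j ∷ js) (i ∷ is)
    ≡⟨ γγᵀ-∷ d e a b j i js is ⟩
  M·Mᵀ d e j i * γγᵀ a b js is
    ≡⟨ cong₂ _*_ (M·Mᵀ-symmetry d e i j) (γγᵀ-symmetry a b is js) ⟩
  sign s * M·Mᵀ d e i j * (sign t * γγᵀ a b is js)
    ≡⟨ interchange (sign s) (M·Mᵀ d e i j) (sign t) (γγᵀ a b is js) ⟩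
  sign s * sign t * (M·Mᵀ d e i j * γγᵀ a b is js)
    ≡⟨ cong₂ _*_ (sym (sign-xor s t)) (sym (γγᵀ-∷ d e a b i j is js)) ⟩
  sign (s xor t) * γγᵀ (d ∷ a) (e ∷ b) (i ∷ is) (j ∷ js)
    ∎
  where
  open ≡-Reasoning
  s t : Bool
  s = digitSkew d e
  t = isSkew a b

γγᵀ-nonzero : ∀ {m} (a b : Vertex m) → γγᵀ a b (replicate m false) (support a ⊕ support b) ≢ + 0
γγᵀ-nonzero []      []      = λ ()
γγᵀ-nonzero (d ∷ a) (e ∷ b) γγᵀ≡0 =
  x*y≢0 (M·Mᵀ-nonzero d e) (γγᵀ-nonzero a b) (trans (sym (γγᵀ-∷ d e a b _ _ _ _)) γγᵀ≡0)

signed-symmetric⇔ : ∀ {m} {P : Mat m} s → (∀ i j → P j i ≡ sign s * P i j) →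
  ∀ {i₀ j₀} → P i₀ j₀ ≢ + 0 → Symmetric P ⇔ s ≡ false
signed-symmetric⇔ false P-symmetry _   = mk⇔ (λ _ → refl) λ _ i j →
  sym (trans (P-symmetry i j) (*-identityˡ _))
signed-symmetric⇔ true  P-symmetry P≢0 = mk⇔ (λ symmetric → contradiction (x≡-x⇒x≡0
  (trans (symmetric _ _) (trans (P-symmetry _ _) (-1*i≡-i _)))) P≢0) λ ()

signed-skew⇔ : ∀ {m} {P : Mat m} s → (∀ i j → P j i ≡ sign s * P i j) →
  ∀ {i₀ j₀} → P i₀ j₀ ≢ + 0 → Skew P ⇔ s ≡ true
signed-skew⇔ true  P-symmetry _   = mk⇔ (λ _ → refl) λ _ i j →
  sym (trans (cong -_ (trans (P-symmetry i j) (-1*i≡-i _))) (neg-involutive _))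
signed-skew⇔ false P-symmetry P≢0 = mk⇔ (λ skew → contradiction (x≡-x⇒x≡0
  (trans (skew _ _) (cong -_ (trans (P-symmetry _ _) (*-identityˡ _))))) P≢0) λ ()

amicable⇔ : ∀ {m} (a b : Vertex m) → Amicable (γ a) (γ b) ⇔ isSkew a b ≡ false
amicable⇔ a b = signed-symmetric⇔ (isSkew a b) (γγᵀ-symmetry a b) (γγᵀ-nonzero a b)

antiAmicable⇔ : ∀ {m} (a b : Vertex m) → AntiAmicable (γ a) (γ b) ⇔ isSkew a b ≡ true
antiAmicable⇔ a b = signed-skew⇔ (isSkew a b) (γγᵀ-symmetry a b) (γγᵀ-nonzero a b)

adj⇔ : ∀ {m} (a b : Vertex m) → Adj a b ⇔ (a ≢ b × support a ≢ support b)
adj⇔ a b = ⇔-id _ ×-⇔ disjointSupport⇔support≢ a b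

red⇔ : ∀ {m} (a b : Vertex m) → Red a b ⇔ (Adj a b × isSkew a b ≡ true)
red⇔ a b = ⇔-id _ ×-⇔ antiAmicable⇔ a b

blue⇔ : ∀ {m} (a b : Vertex m) → Blue a b ⇔ (Adj a b × isSkew a b ≡ false)
blue⇔ a b = ⇔-id _ ×-⇔ amicable⇔ a b

-- Transversals with only red edges

digitSkew-diagonal : ∀ d e → digitSupport d ≡ false → digitSupport e ≡ false → digitSkew d e ≡ false
digitSkew-diagonal = from-yes $ all? λ d → all? λ e →
  (digitSupport d ≟ᵇ false) →-dec (digitSupport e ≟ᵇ false) →-dec (digitSkew d e ≟ᵇ false)

record RedSection (m : ℕ) : Set where
  field
    pick         : Vec Bool m → Vertex m
    support-pick : ∀ x → support (pick x) ≡ x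
    skew-pick    : ∀ {x y} → x ≢ y → isSkew (pick x) (pick y) ≡ true

-- Leading digits with support bit false are 0 and 3, whose factors I and E₁E₂ are mutually amicable.
restrict : ∀ {m} → RedSection (suc m) → RedSection m
restrict {m} S = record { pick = pick′ ; support-pick = support-pick′ ; skew-pick = skew-pick′ }
  where
  open RedSection S
  pick′ : Vec Bool m → Vertex m
  pick′ x = Vec.tail (pick (false ∷ x))
  support-pick′ : ∀ x → support (pick′ x) ≡ x
  support-pick′ x with pick (false ∷ x) | support-pick (false ∷ x)
  ... | _ ∷ _ | support≡ = proj₂ (∷-injective support≡)
  skew-pick′ : ∀ {x y} → x ≢ y → isSkew (pick′ x) (pick′ y) ≡ true
  skew-pick′ {x} {y} x≢y
    with pick (false ∷ x) | support-pick (false ∷ x) | pick (false ∷ y) | support-pick (false ∷ y)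
       | skew-pick {false ∷ x} {false ∷ y} (x≢y ∘ proj₂ ∘ ∷-injective)
  ... | d ∷ v | support-d∷v | e ∷ w | support-e∷w | skew =
    trans (cong (_xor isSkew v w) (sym diagonal)) skew
    where
    diagonal : digitSkew d e ≡ false
    diagonal = digitSkew-diagonal d e (proj₁ (∷-injective support-d∷v)) (proj₁ (∷-injective support-e∷w))

digitsWithSupport : Bool → List (Fin 4)
digitsWithSupport false = 0F ∷ 3F ∷ []
digitsWithSupport true  = 1F ∷ 2F ∷ []

∈-digitsWithSupport : ∀ d → d ∈ digitsWithSupport (digitSupport d)
∈-digitsWithSupport 0F = here refl
∈-digitsWithSupport 1F = here refl
∈-digitsWithSupport 2F = there (here refl)
∈-digitsWithSupport 3F = there (here refl)

verticesWithSupport : ∀ {m} → Vec Bool m → List (Vertex m)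
verticesWithSupport []      = [] ∷ []
verticesWithSupport (b ∷ x) = cartesianProductWith _∷_ (digitsWithSupport b) (verticesWithSupport x)

∈-verticesWithSupport : ∀ {m} (v : Vertex m) → v ∈ verticesWithSupport (support v)
∈-verticesWithSupport []      = here refl
∈-verticesWithSupport (d ∷ v) =
  ∈-cartesianProductWith⁺ _∷_ (∈-digitsWithSupport d) (∈-verticesWithSupport v)

extendable : ∀ {m} → List (Vertex m) → List (Vec Bool m) → Bool
extendable chosen []       = true
extendable chosen (x ∷ xs) =
  any (λ v → all (isSkew v) chosen ∧ extendable (v ∷ chosen) xs) (verticesWithSupport x)

extendable-pick : ∀ {m} (S : RedSection m) → let open RedSection S in
  ∀ chosen xs → AllPairs _≢_ xs → All (λ x → All (T ∘ isSkew (pick x)) chosen) xs →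
  T (extendable chosen xs)
extendable-pick S chosen []       _                  _               = _
extendable-pick S chosen (x ∷ xs) (x≢xs ∷ xs-distinct) (x-ok ∷ xs-ok) =
  any⁺ _ (lose pick-x∈ (Equivalence.from T-∧
    (all⁻ _ x-ok , extendable-pick S (pick x ∷ chosen) xs xs-distinct xs-ok′)))
  where
  open RedSection S
  pick-x∈ : pick x ∈ verticesWithSupport x
  pick-x∈ = subst (λ s → pick x ∈ verticesWithSupport s) (support-pick x)
                  (∈-verticesWithSupport (pick x))
  xs-ok′ : All (λ y → All (T ∘ isSkew (pick y)) (pick x ∷ chosen)) xs
  xs-ok′ = All.zipWith (λ (x≢y , y-ok) → Equivalence.from T-≡ (skew-pick (x≢y ∘ sym)) ∷ y-ok)
                       (x≢xs , xs-ok)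

-- Any order is correct; this one makes the backtracking search fail quickly.
searchOrder : List (Vec Bool 4)
searchOrder =
    (o ∷ o ∷ i ∷ o ∷ []) ∷ (i ∷ o ∷ i ∷ i ∷ []) ∷ (o ∷ o ∷ i ∷ i ∷ []) ∷ (i ∷ i ∷ i ∷ o ∷ [])
  ∷ (i ∷ i ∷ o ∷ o ∷ []) ∷ (i ∷ o ∷ o ∷ o ∷ []) ∷ (i ∷ i ∷ i ∷ i ∷ []) ∷ (o ∷ i ∷ i ∷ o ∷ [])
  ∷ (o ∷ i ∷ o ∷ o ∷ []) ∷ (o ∷ i ∷ i ∷ i ∷ []) ∷ (o ∷ o ∷ o ∷ o ∷ []) ∷ (o ∷ i ∷ o ∷ i ∷ [])
  ∷ (i ∷ o ∷ o ∷ i ∷ []) ∷ (i ∷ o ∷ i ∷ o ∷ []) ∷ (i ∷ i ∷ o ∷ i ∷ []) ∷ (o ∷ o ∷ o ∷ i ∷ []) ∷ []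
  where
  o i : Bool
  o = false
  i = true

noRedSection₄ : ¬ RedSection 4
noRedSection₄ S = extendable-pick S [] searchOrder
  (from-yes (allPairs? (λ x y → ¬? (≡-dec _≟ᵇ_ x y)) searchOrder))
  (All.universal (λ _ → []) searchOrder)

noRedSection : ∀ {m} → 4 ≤ m → ¬ RedSection m
noRedSection = go ∘ ≤⇒≤′
  where
  go : ∀ {m} → 4 ≤′ m → ¬ RedSection m
  go ≤′-refl        = noRedSection₄
  go (≤′-step 4≤′m) = go 4≤′m ∘ restrict

∷↔× : ∀ {A : Set} {n} → (A × Vec A n) ↔ Vec A (suc n)
∷↔× = mk↔ₛ′ (uncurry _∷_) (λ xs → Vec.head xs , Vec.tail xs) (λ { (_ ∷ _) → refl }) (λ _ → refl)

Fin[2^m]↔Vec : ∀ m → Fin (2 ^ m) ↔ Vec Bool m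
Fin[2^m]↔Vec zero    = mk↔ₛ′ (λ _ → []) (λ _ → zero) (λ { [] → refl }) (λ { zero → refl })
Fin[2^m]↔Vec (suc m) = ↔-trans *↔× (↔-trans (2↔Bool ×-↔ Fin[2^m]↔Vec m) ∷↔×)

injective⇒surjective : ∀ {n} {f : Fin n → Fin n} → Injective _≡_ _≡_ f → ∀ y → ∃ λ x → f x ≡ y
injective⇒surjective {suc n} {f} f-injective y with any? (λ x → f x ≟ꟳ y)
... | yes hit  = hit
... | no  miss = ⊥-elim (<⇒notInjective (n<1+n n) f′-injective)
  where
  missed : ∀ x → y ≢ f x
  missed x y≡fx = miss (x , sym y≡fx)
  f′ : Fin (suc n) → Fin n
  f′ x = punchOut (missed x)
  f′-injective : Injective _≡_ _≡_ f′
  f′-injective {x} {x′} = f-injective ∘ punchOut-injective (missed x) (missed x′)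

AllRed AllBlue : ∀ {m} → Transversal m → Set
AllRed  T = ∀ i j → i ≢ j → Red  (vert T i) (vert T j)
AllBlue T = ∀ i j → i ≢ j → Blue (vert T i) (vert T j)

-- The 2^m vertices of a transversal have pairwise distinct supports, so every support occurs.
redSection : ∀ {m} (T : Transversal m) → AllRed T → RedSection m
redSection {m} T allRed =
  record { pick = vert T ∘ index ; support-pick = support-pick ; skew-pick = skew-pick }
  where
  code : Vec Bool m → Fin (2 ^ m)
  code = Inverse.from (Fin[2^m]↔Vec m)
  code-injective : Injective _≡_ _≡_ code
  code-injective = Injection.injective (Inverse⇒Injection (↔-sym (Fin[2^m]↔Vec m)))
  codeOfVertex-injective : Injective _≡_ _≡_ (code ∘ support ∘ vert T)
  codeOfVertex-injective {i} {j} same with i ≟ꟳ j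
  ... | yes i≡j = i≡j
  ... | no  i≢j =
    contradiction (code-injective same) (proj₂ (Equivalence.to (adj⇔ _ _) (complete T i j i≢j)))
  index : Vec Bool m → Fin (2 ^ m)
  index x = proj₁ (injective⇒surjective codeOfVertex-injective (code x))
  support-pick : ∀ x → support (vert T (index x)) ≡ x
  support-pick x = code-injective (proj₂ (injective⇒surjective codeOfVertex-injective (code x)))
  skew-pick : ∀ {x y} → x ≢ y → isSkew (vert T (index x)) (vert T (index y)) ≡ true
  skew-pick {x} {y} x≢y = proj₂ (Equivalence.to (red⇔ _ _) (allRed _ _ λ same →
    x≢y (trans (sym (support-pick x)) (trans (cong (support ∘ vert T) same) (support-pick y)))))

noRedTransversal : ∀ {m} → 4 ≤ m → (T : Transversal m) → ¬ AllRed T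
noRedTransversal 4≤m T = noRedSection 4≤m ∘ redSection T

-- The all-blue transversal

symmetricDigit : Bool → Fin 4
symmetricDigit false = 0F
symmetricDigit true  = 2F

symmetricVertex : ∀ {m} → Vec Bool m → Vertex m
symmetricVertex = Vec.map symmetricDigit

support-symmetricVertex : ∀ {m} (x : Vec Bool m) → support (symmetricVertex x) ≡ x
support-symmetricVertex []          = refl
support-symmetricVertex (false ∷ x) = cong (false ∷_) (support-symmetricVertex x)
support-symmetricVertex (true  ∷ x) = cong (true ∷_) (support-symmetricVertex x)

isSkew-symmetricVertex : ∀ {m} (x y : Vec Bool m) →
  isSkew (symmetricVertex x) (symmetricVertex y) ≡ false
isSkew-symmetricVertex []          []          = refl
isSkew-symmetricVertex (false ∷ x) (false ∷ y) = isSkew-symmetricVertex x y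
isSkew-symmetricVertex (false ∷ x) (true  ∷ y) = isSkew-symmetricVertex x y
isSkew-symmetricVertex (true  ∷ x) (false ∷ y) = isSkew-symmetricVertex x y
isSkew-symmetricVertex (true  ∷ x) (true  ∷ y) = isSkew-symmetricVertex x y

bits : ∀ m → Fin (2 ^ m) → Vec Bool m
bits m = Inverse.to (Fin[2^m]↔Vec m)

blueTransversal : ∀ m → Transversal m
blueTransversal m = record { vert = symmetricVertex ∘ bits m ; complete = complete′ }
  where
  complete′ : ∀ i j → i ≢ j → Adj (symmetricVertex (bits m i)) (symmetricVertex (bits m j))
  complete′ i j i≢j = Equivalence.from (adj⇔ _ _) (support≢ ∘ cong support , support≢)
    where
    support≢ : support (symmetricVertex (bits m i)) ≢ support (symmetricVertex (bits m j))
    support≢ same = i≢j (Injection.injective (Inverse⇒Injection (Fin[2^m]↔Vec m))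
      (trans (sym (support-symmetricVertex _)) (trans same (support-symmetricVertex _))))

blueTransversal-allBlue : ∀ {m} → AllBlue (blueTransversal m)
blueTransversal-allBlue {m} i j i≢j =
  Equivalence.from (blue⇔ _ _)
    (complete (blueTransversal m) i j i≢j , isSkew-symmetricVertex (bits m i) (bits m j))

complement-allBlue : ∀ {m} (T T′ : Transversal m) →
  AllBlue T → EdgeColourComplementary T T′ → AllRed T′
complement-allBlue T T′ allBlue (σ , swap) i j i≢j =
  subst₂ (λ k l → Red (vert T′ k) (vert T′ l)) (strictlyInverseˡ i) (strictlyInverseˡ j)
    (Equivalence.to (proj₂ (swap (from i) (from j) from-i≢from-j))
                    (allBlue (from i) (from j) from-i≢from-j))
  where
  open Inverse σ
  from-i≢from-j : from i ≢ from j
  from-i≢from-j = i≢j ∘ Injection.injective (Inverse⇒Injection (↔-sym σ))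

blueTransversal-noComplement : ∀ {m} → 4 ≤ m → ∀ T → ¬ EdgeColourComplementary (blueTransversal m) T
blueTransversal-noComplement 4≤m T =
  noRedTransversal 4≤m T ∘ complement-allBlue (blueTransversal _) T blueTransversal-allBlue

noComplementaryPairing : ∀ {m} → 4 ≤ m →
  ¬ Σ ((T : Transversal m) → ¬ SelfEdgeColourComplementary T → Transversal m) IsComplementaryPairing
noComplementaryPairing {m} 4≤m (pair , complementary , _) =
  blueTransversal-noComplement 4≤m (pair T₀ T₀-notSelf) (complementary T₀ T₀-notSelf)
  where
  T₀ : Transversal m
  T₀ = blueTransversal m
  T₀-notSelf : ¬ SelfEdgeColourComplementary T₀
  T₀-notSelf = blueTransversal-noComplement 4≤m T₀

swapImage : ∀ {m} (π : Vertex m ↔ Vertex m) → SwapsColours π → (T : Transversal m) → AllBlue T →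
  Σ (Transversal m) AllRed
swapImage π swaps T allBlue =
  record { vert = Inverse.to π ∘ vert T ; complete = λ i j i≢j → proj₁ (red i j i≢j) } , red
  where
  red : ∀ i j → i ≢ j → Red (Inverse.to π (vert T i)) (Inverse.to π (vert T j))
  red i j i≢j = proj₁ (swaps _ _) (allBlue i j i≢j)

noColourSwap : ∀ {m} → 4 ≤ m → ¬ Σ (Vertex m ↔ Vertex m) SwapsColours
noColourSwap 4≤m (π , swaps) =
  uncurry (noRedTransversal 4≤m) (swapImage π swaps (blueTransversal _) blueTransversal-allBlue)

colourSwappingAutomorphism⇒≤3 : ∀ {m} → Σ (Vertex m ↔ Vertex m) IsColourSwappingAutomorphism → m ≤ 3
colourSwappingAutomorphism⇒≤3 {m} (π , automorphism) with m ≤ℕ? 3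
... | yes m≤3 = m≤3
... | no  m≰3 = ⊥-elim (noColourSwap (≰⇒> m≰3) (π , λ a b →
  Equivalence.to (proj₂ (proj₂ (automorphism a b))) , Equivalence.to (proj₁ (proj₂ (automorphism a b)))))

-- Colour-swapping involutions for m ≤ 3

VertexTable : ℕ → Set → Set
VertexTable zero    A = A
VertexTable (suc m) A = Vec (VertexTable m A) 4

lookupTable : ∀ {m} {A : Set} → VertexTable m A → Vertex m → A
lookupTable t []      = t
lookupTable t (d ∷ v) = lookupTable (Vec.lookup t d) v

∀-Vertex? : ∀ {m} {P : Vertex m → Set} → Decidable P → Dec (∀ v → P v)
∀-Vertex? {zero}  P? = map′ (λ p → λ { [] → p }) (λ h → h []) (P? [])
∀-Vertex? {suc m} P? =
  map′ (λ h → λ { (d ∷ v) → h d v }) (λ h d v → h (d ∷ v)) (all? λ d → ∀-Vertex? λ v → P? (d ∷ v))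

involutive? : ∀ {m} (π : Vertex m → Vertex m) → Dec (Involutive _≡_ π)
involutive? π = ∀-Vertex? λ a → ≡-dec _≟ꟳ_ (π (π a)) a

ColourSwapping : ∀ {m} → (Vertex m → Vertex m) → Set
ColourSwapping π = ∀ a b → support a ≢ support b →
  support (π a) ≢ support (π b) × isSkew (π a) (π b) ≡ not (isSkew a b)

colourSwapping? : ∀ {m} (π : Vertex m → Vertex m) → Dec (ColourSwapping π)
colourSwapping? π = ∀-Vertex? λ a → ∀-Vertex? λ b →
  ¬? (≡-dec _≟ᵇ_ (support a) (support b)) →-dec
    (¬? (≡-dec _≟ᵇ_ (support (π a)) (support (π b))) ×-dec (isSkew (π a) (π b) ≟ᵇ not (isSkew a b)))

colourSwappingInvolution : ∀ {m} (π : Vertex m → Vertex m) → Involutive _≡_ π → ColourSwapping π →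
  Σ (Vertex m ↔ Vertex m) IsColourSwappingAutomorphism
colourSwappingInvolution {m} π involutive swapping =
  mk↔ₛ′ π π involutive involutive , λ a b →
    mk⇔ adj→ (undo {Adj} ∘ adj→) , mk⇔ red→ (undo {Red} ∘ blue→) , mk⇔ blue→ (undo {Blue} ∘ red→)
  where
  undo : ∀ {R : Vertex m → Vertex m → Set} {a b} → R (π (π a)) (π (π b)) → R a b
  undo {R} = subst₂ R (involutive _) (involutive _)
  adj→ : ∀ {a b} → Adj a b → Adj (π a) (π b)
  adj→ {a} {b} adj with Equivalence.to (adj⇔ a b) adj
  ... | a≢b , support≢ = Equivalence.from (adj⇔ _ _) (a≢b ∘ π-injective , proj₁ (swapping a b support≢))
    where
    π-injective : π a ≡ π b → a ≡ b
    π-injective same = trans (sym (involutive a)) (trans (cong π same) (involutive b))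
  skew : ∀ {a b} → Adj a b → isSkew (π a) (π b) ≡ not (isSkew a b)
  skew {a} {b} adj = proj₂ (swapping a b (proj₂ (Equivalence.to (adj⇔ a b) adj)))
  red→ : ∀ {a b} → Red a b → Blue (π a) (π b)
  red→ {a} {b} (adj , antiAmicable) = Equivalence.from (blue⇔ _ _)
    (adj→ adj , trans (skew adj) (cong not (Equivalence.to (antiAmicable⇔ a b) antiAmicable)))
  blue→ : ∀ {a b} → Blue a b → Red (π a) (π b)
  blue→ {a} {b} (adj , amicable) = Equivalence.from (red⇔ _ _)
    (adj→ adj , trans (skew adj) (cong not (Equivalence.to (amicable⇔ a b) amicable)))

verifiedColourSwap : ∀ {m} (π : Vertex m → Vertex m) → {True (involutive? π)} → {True (colourSwapping? π)} →
  Σ (Vertex m ↔ Vertex m) IsColourSwappingAutomorphism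
verifiedColourSwap π {involutive} {swapping} = colourSwappingInvolution π (toWitness involutive) (toWitness swapping)

-- Found by computer search; for m = 3 no affine map of the digit group ℤ₂^(2m) swaps the colours.
colourSwap₁ : Vertex 1 → Vertex 1
colourSwap₁ = lookupTable
  ( (0F ∷ []) ∷ (2F ∷ []) ∷ (1F ∷ []) ∷ (3F ∷ []) ∷ [])

colourSwap₂ : Vertex 2 → Vertex 2
colourSwap₂ = lookupTable
  ( ((0F ∷ 0F ∷ []) ∷ (0F ∷ 2F ∷ []) ∷ (0F ∷ 1F ∷ []) ∷ (0F ∷ 3F ∷ []) ∷ [])
  ∷ ((2F ∷ 3F ∷ []) ∷ (2F ∷ 1F ∷ []) ∷ (2F ∷ 2F ∷ []) ∷ (2F ∷ 0F ∷ []) ∷ [])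
  ∷ ((1F ∷ 3F ∷ []) ∷ (1F ∷ 1F ∷ []) ∷ (1F ∷ 2F ∷ []) ∷ (1F ∷ 0F ∷ []) ∷ [])
  ∷ ((3F ∷ 0F ∷ []) ∷ (3F ∷ 2F ∷ []) ∷ (3F ∷ 1F ∷ []) ∷ (3F ∷ 3F ∷ []) ∷ [])
  ∷ [])

colourSwap₃ : Vertex 3 → Vertex 3
colourSwap₃ = lookupTable
  ( ( ((0F ∷ 0F ∷ 0F ∷ []) ∷ (0F ∷ 0F ∷ 2F ∷ []) ∷ (0F ∷ 0F ∷ 1F ∷ []) ∷ (0F ∷ 0F ∷ 3F ∷ []) ∷ [])
    ∷ ((0F ∷ 2F ∷ 3F ∷ []) ∷ (3F ∷ 2F ∷ 1F ∷ []) ∷ (3F ∷ 2F ∷ 2F ∷ []) ∷ (0F ∷ 2F ∷ 0F ∷ []) ∷ [])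
    ∷ ((0F ∷ 1F ∷ 3F ∷ []) ∷ (3F ∷ 1F ∷ 1F ∷ []) ∷ (3F ∷ 1F ∷ 2F ∷ []) ∷ (0F ∷ 1F ∷ 0F ∷ []) ∷ [])
    ∷ ((0F ∷ 3F ∷ 0F ∷ []) ∷ (0F ∷ 3F ∷ 2F ∷ []) ∷ (0F ∷ 3F ∷ 1F ∷ []) ∷ (0F ∷ 3F ∷ 3F ∷ []) ∷ [])
    ∷ [])
  ∷ ( ((2F ∷ 3F ∷ 3F ∷ []) ∷ (2F ∷ 0F ∷ 1F ∷ []) ∷ (2F ∷ 0F ∷ 2F ∷ []) ∷ (2F ∷ 3F ∷ 0F ∷ []) ∷ [])
    ∷ ((2F ∷ 1F ∷ 3F ∷ []) ∷ (1F ∷ 2F ∷ 1F ∷ []) ∷ (1F ∷ 2F ∷ 2F ∷ []) ∷ (2F ∷ 1F ∷ 0F ∷ []) ∷ [])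
    ∷ ((2F ∷ 2F ∷ 3F ∷ []) ∷ (1F ∷ 1F ∷ 1F ∷ []) ∷ (1F ∷ 1F ∷ 2F ∷ []) ∷ (2F ∷ 2F ∷ 0F ∷ []) ∷ [])
    ∷ ((2F ∷ 0F ∷ 3F ∷ []) ∷ (2F ∷ 3F ∷ 1F ∷ []) ∷ (2F ∷ 3F ∷ 2F ∷ []) ∷ (2F ∷ 0F ∷ 0F ∷ []) ∷ [])
    ∷ [])
  ∷ ( ((1F ∷ 3F ∷ 3F ∷ []) ∷ (1F ∷ 0F ∷ 1F ∷ []) ∷ (1F ∷ 0F ∷ 2F ∷ []) ∷ (1F ∷ 3F ∷ 0F ∷ []) ∷ [])
    ∷ ((1F ∷ 1F ∷ 3F ∷ []) ∷ (2F ∷ 2F ∷ 1F ∷ []) ∷ (2F ∷ 2F ∷ 2F ∷ []) ∷ (1F ∷ 1F ∷ 0F ∷ []) ∷ [])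
    ∷ ((1F ∷ 2F ∷ 3F ∷ []) ∷ (2F ∷ 1F ∷ 1F ∷ []) ∷ (2F ∷ 1F ∷ 2F ∷ []) ∷ (1F ∷ 2F ∷ 0F ∷ []) ∷ [])
    ∷ ((1F ∷ 0F ∷ 3F ∷ []) ∷ (1F ∷ 3F ∷ 1F ∷ []) ∷ (1F ∷ 3F ∷ 2F ∷ []) ∷ (1F ∷ 0F ∷ 0F ∷ []) ∷ [])
    ∷ [])
  ∷ ( ((3F ∷ 0F ∷ 0F ∷ []) ∷ (3F ∷ 0F ∷ 2F ∷ []) ∷ (3F ∷ 0F ∷ 1F ∷ []) ∷ (3F ∷ 0F ∷ 3F ∷ []) ∷ [])
    ∷ ((3F ∷ 2F ∷ 3F ∷ []) ∷ (0F ∷ 2F ∷ 1F ∷ []) ∷ (0F ∷ 2F ∷ 2F ∷ []) ∷ (3F ∷ 2F ∷ 0F ∷ []) ∷ [])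
    ∷ ((3F ∷ 1F ∷ 3F ∷ []) ∷ (0F ∷ 1F ∷ 1F ∷ []) ∷ (0F ∷ 1F ∷ 2F ∷ []) ∷ (3F ∷ 1F ∷ 0F ∷ []) ∷ [])
    ∷ ((3F ∷ 3F ∷ 0F ∷ []) ∷ (3F ∷ 3F ∷ 2F ∷ []) ∷ (3F ∷ 3F ∷ 1F ∷ []) ∷ (3F ∷ 3F ∷ 3F ∷ []) ∷ [])
    ∷ [])
  ∷ [])

colourSwappingAutomorphism : ∀ {m} → 1 ≤ m → m ≤ 3 → Σ (Vertex m ↔ Vertex m) IsColourSwappingAutomorphism
colourSwappingAutomorphism {0} () _
colourSwappingAutomorphism {1} _ _ = verifiedColourSwap colourSwap₁
colourSwappingAutomorphism {2} _ _ = verifiedColourSwap colourSwap₂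
colourSwappingAutomorphism {3} _ _ = verifiedColourSwap colourSwap₃
colourSwappingAutomorphism {suc (suc (suc (suc _)))} _ (s≤s (s≤s (s≤s ())))

theorem3 : (∀ (m : ℕ) → 4 ≤ m →
    Σ (Transversal m) (λ T → ∀ (T' : Transversal m) → ¬ EdgeColourComplementary T T')
    × ¬ Σ ((T : Transversal m) → ¬ SelfEdgeColourComplementary T → Transversal m) IsComplementaryPairing
    × ¬ Σ (Vertex m ↔ Vertex m) SwapsColours)
    × (∀ (m : ℕ) → 1 ≤ m → (Σ (Vertex m ↔ Vertex m) IsColourSwappingAutomorphism ⇔ m ≤ 3))
theorem3 =
    (λ m 4≤m → (blueTransversal m , blueTransversal-noComplement 4≤m)
             , noComplementaryPairing 4≤m
             , noColourSwap 4≤m)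
  , (λ m 1≤m → mk⇔ colourSwappingAutomorphism⇒≤3 (colourSwappingAutomorphism 1≤m))
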